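{- Let $n \ge 1$ and let $s$ be an even integer with $0 \le s \le n(n-1)$. Let $T(n,s)$ be the integer sequence of length $n$ defined recursively below. Put \[ p = \left\lfloor \frac{\sqrt{4s+1}-1}{2} \right\rfloor, \qquad q = \frac{s - p(p+1)}{2}. \] Then $T(n,s) = \langle (p+1)^{q}, p^{p+1-q}, q, 0^{n-p-2}\rangle$. Here any trailing entries that would fall beyond position $n$ are equal to $0$ and are dropped. Equivalently, for each $1 \le i \le n$ the $i$-th entry of $T(n,s)$ is \[ T(n,s)_i = \begin{cases} p+1 & \text{if } i \le q,\\ p & \text{if } q < i \le p+1,\\ q & \text{if } i = p+2,\\ 0 & \text{if } i > p+2.\end{cases} \]
   Context: Notation: $\langle a^r \rangle$ denotes the constant subsequence $\langle a,\dots,a\rangle$ consisting of $r$ copies of $a$. Sequences are written with angle brackets and concatenated; for example $\langle \gamma_1,\dots,\gamma_m,0^{n-m}\rangle$. Definition of $T(n,s)$. Let $m = \min\{k : s \le k(k-1)\}$. Then \[ T(n,s) = \begin{cases} \langle 0^{n}\rangle & \text{if } s=0,\\ \langle \gamma_1,\dots,\gamma_m,0^{n-m}\rangle \text{ where } \gamma = T(m,s) & \text{if } n>m,\\ \langle n-1,\gamma_1+1,\dots,\gamma_{n-1}+1\rangle \text{ where } \gamma = T(n-1,s-2(n-1)) & \text{if } n \le m.\end{cases} \] $T(n,s)$ is a nonincreasing sequence of nonnegative integers of length $n$ and sum $s$. -}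

module Defs where

open import Data.Nat using (ℕ; zero; suc; _+_; _*_; _∸_; _≤?_; _<?_)
open import Data.Nat.DivMod using (_/_)
open import Data.List using (List; []; _∷_; _++_; replicate; map)
open import Relation.Nullary using (yes; no)

⌊√_⌋ : ℕ → ℕ
⌊√ zero ⌋ = zero
⌊√ suc x ⌋ with suc ⌊√ x ⌋ * suc ⌊√ x ⌋ ≤? suc x
... | yes _ = suc ⌊√ x ⌋
... | no  _ = ⌊√ x ⌋

-- m(s) = min { k : s ≤ k (k - 1) }.  Linear search from k = 0;
-- the fuel s + 2 suffices since k = s + 1 always satisfies the condition.
mSearch : ℕ → ℕ → ℕ → ℕ
mSearch s zero    k = k
mSearch s (suc f) k with s ≤? k * (k ∸ 1)
... | yes _ = k
... | no  _ = mSearch s f (suc k)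

mOf : ℕ → ℕ
mOf s = mSearch s (suc (suc s)) 0

-- T with fuel; every recursive call decreases n, so fuel n + 1 suffices.
Tf : ℕ → ℕ → ℕ → List ℕ
Tf zero    n       s       = replicate n 0   -- unreachable with enough fuel
Tf (suc f) n       zero    = replicate n 0
Tf (suc f) zero    (suc s) = []              -- degenerate (outside s ≤ n(n-1))
Tf (suc f) (suc n) (suc s) with mOf (suc s) <? suc n
... | yes _ = Tf f (mOf (suc s)) (suc s) ++ replicate (suc n ∸ mOf (suc s)) 0
... | no  _ = n ∷ map suc (Tf f n (suc s ∸ 2 * n))

T : ℕ → ℕ → List ℕ
T n s = Tf (suc n) n s

-- p = ⌊(√(4s+1) - 1)/2⌋ = ⌊(⌊√(4s+1)⌋ - 1)/2⌋ ,  q = (s - p(p+1))/2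
pOf : ℕ → ℕ
pOf s = (⌊√ (4 * s + 1) ⌋ ∸ 1) / 2

qOf : ℕ → ℕ
qOf s = (s ∸ pOf s * (pOf s + 1)) / 2

-- Every even s is p(p+1) + 2q with q ≤ p, and then p and q are exactly pOf s and qOf s,
-- since 4s + 1 = (2p+1)² + 8q lies in [(2p+1)², (2p+3)²). A positive s can also be written
-- in block form p(p+1) + 2q with 1 ≤ q ≤ p + 1 (the canonical (p+1, 0) becomes (p, p+1));
-- then m(s) = p + 2. For n > p + 2 the sequence T(n,s) is T(p+2,s) padded with zeros, and at
-- n = p + 2 one step of the recursion subtracts 2(p+1), turning (p, q) into (p-1, q-1), and
-- prepends p + 1 while adding 1 to every entry: exactly how ⟨(p+1)^q, p^(p+1-q), q⟩ arises
-- from ⟨p^(q-1), (p-1)^(p+1-q), q-1⟩.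
module Submission where

open import Defs
open import Data.Nat using (ℕ; zero; suc; _+_; _*_; _∸_; _≤_; _≥_; _<_; _<?_; NonZero; z≤n; s≤s; z<s)
open import Data.Nat.Properties
open import Data.Nat.DivMod using (_/_; m*n/n≡m; m<n⇒m/n≡0; +-distrib-/-∣ˡ)
open import Data.Nat.Divisibility using (_∣_; divides)
open import Data.Nat.Tactic.RingSolver using (solve-∀)
open import Data.List using (List; []; _∷_; _++_; replicate; take; map; length)
open import Data.List.Properties
  using (map-++; map-replicate; ++-assoc; ++-identityʳ; length-replicate; length-++; take-all)
open import Data.Product using (∃-syntax; _×_; _,_; proj₁; proj₂)
open import Data.Sum using (inj₁; inj₂)
open import Relation.Nullary using (yes; no; contradiction)
open import Relation.Binary.PropositionalEquality
  using (_≡_; refl; sym; trans; cong; cong₂; subst; module ≡-Reasoning)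

⌊√⌋-spec : ∀ x → ⌊√ x ⌋ * ⌊√ x ⌋ ≤ x × x < suc ⌊√ x ⌋ * suc ⌊√ x ⌋
⌊√⌋-spec zero = z≤n , s≤s z≤n
⌊√⌋-spec (suc x) with suc ⌊√ x ⌋ * suc ⌊√ x ⌋ ≤? suc x
... | yes r²≤x = r²≤x , <-≤-trans (s≤s (proj₂ (⌊√⌋-spec x))) (*-mono-< r<1+r r<1+r)
  where r<1+r = n<1+n (suc ⌊√ x ⌋)
... | no  r²≰x = ≤-trans (proj₁ (⌊√⌋-spec x)) (n≤1+n x) , ≰⇒> r²≰x

≤⌊√⌋ : ∀ {a x} → a * a ≤ x → a ≤ ⌊√ x ⌋
≤⌊√⌋ {x = x} a²≤x = ≮⇒≥ λ r<a → <⇒≱ (proj₂ (⌊√⌋-spec x)) (≤-trans (*-mono-≤ r<a r<a) a²≤x)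

⌊√⌋< : ∀ {b x} → x < b * b → ⌊√ x ⌋ < b
⌊√⌋< {x = x} x<b² = ≰⇒> λ b≤r → <⇒≱ x<b² (≤-trans (*-mono-≤ b≤r b≤r) (proj₁ (⌊√⌋-spec x)))

/-unique : ∀ {m n q} .{{_ : NonZero n}} → q * n ≤ m → m < n + q * n → m / n ≡ q
/-unique {n = n} {q} qn≤m m<n+qn with m≤n⇒∃[o]m+o≡n qn≤m
... | r , refl = begin
  (q * n + r) / n     ≡⟨ +-distrib-/-∣ˡ r (divides q refl) ⟩
  q * n / n + r / n   ≡⟨ cong₂ _+_ (m*n/n≡m q n) (m<n⇒m/n≡0 r<n) ⟩
  q + 0               ≡⟨ +-identityʳ q ⟩
  q                   ∎
  where
  open ≡-Reasoning
  r<n : r < n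
  r<n = +-cancelˡ-< (q * n) r n (subst (q * n + r <_) (+-comm n (q * n)) m<n+qn)

pOf-p[p+1]+2q : ∀ {p q} → q ≤ p → pOf (p * (p + 1) + 2 * q) ≡ p
pOf-p[p+1]+2q {p} {q} q≤p =
  /-unique (∸-monoˡ-≤ 1 lower) (∸-monoˡ-< upper (≤-trans (s≤s z≤n) lower))
  where
  x = 4 * (p * (p + 1) + 2 * q) + 1

  square : ∀ p q → suc (p * 2) * suc (p * 2) + 8 * q ≡ 4 * (p * (p + 1) + 2 * q) + 1
  square = solve-∀

  lower : suc (p * 2) ≤ ⌊√ x ⌋
  lower = ≤⌊√⌋ (begin
    suc (p * 2) * suc (p * 2)          ≤⟨ m≤m+n _ (8 * q) ⟩
    suc (p * 2) * suc (p * 2) + 8 * q  ≡⟨ square p q ⟩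
    x                                  ∎)
    where open ≤-Reasoning

  upper : ⌊√ x ⌋ < 3 + p * 2
  upper = ⌊√⌋< (begin-strict
    x                                       ≡⟨ sym (square p q) ⟩
    suc (p * 2) * suc (p * 2) + 8 * q       ≤⟨ +-monoʳ-≤ (suc (p * 2) * suc (p * 2)) (*-monoʳ-≤ 8 q≤p) ⟩
    suc (p * 2) * suc (p * 2) + 8 * p       <⟨ m<m+n _ z<s ⟩
    suc (p * 2) * suc (p * 2) + 8 * p + 8   ≡⟨ next-square p ⟩
    (3 + p * 2) * (3 + p * 2)               ∎)
    where
    open ≤-Reasoning
    next-square : ∀ p → suc (p * 2) * suc (p * 2) + 8 * p + 8 ≡ (3 + p * 2) * (3 + p * 2)
    next-square = solve-∀

qOf-p[p+1]+2q : ∀ {p q} → q ≤ p → qOf (p * (p + 1) + 2 * q) ≡ q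
qOf-p[p+1]+2q {p} {q} q≤p = begin
  (s ∸ pOf s * (pOf s + 1)) / 2  ≡⟨ cong (λ r → (s ∸ r * (r + 1)) / 2) (pOf-p[p+1]+2q q≤p) ⟩
  (s ∸ p * (p + 1)) / 2          ≡⟨ cong (_/ 2) (trans (m+n∸m≡n (p * (p + 1)) (2 * q)) (*-comm 2 q)) ⟩
  q * 2 / 2                      ≡⟨ m*n/n≡m q 2 ⟩
  q                              ∎
  where
  open ≡-Reasoning
  s = p * (p + 1) + 2 * q

even≡p[p+1]+2q : ∀ k → ∃[ p ] ∃[ q ] q ≤ p × k * 2 ≡ p * (p + 1) + 2 * q
even≡p[p+1]+2q zero = 0 , 0 , z≤n , refl
even≡p[p+1]+2q (suc k) with even≡p[p+1]+2q k
... | p , q , q≤p , eq with m≤n⇒m<n∨m≡n q≤p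
...   | inj₁ q<p  = p , suc q , q<p , trans (cong (2 +_) eq) (raise-q p q)
  where
  raise-q : ∀ p q → 2 + (p * (p + 1) + 2 * q) ≡ p * (p + 1) + 2 * suc q
  raise-q = solve-∀
...   | inj₂ refl = suc p , 0 , z≤n , trans (cong (2 +_) eq) (carry p)
  where
  carry : ∀ p → 2 + (p * (p + 1) + 2 * p) ≡ suc p * (suc p + 1) + 2 * 0
  carry = solve-∀

n*[n∸1]≤p[p+1] : ∀ {n p} → n ≤ suc p → n * (n ∸ 1) ≤ p * (p + 1)
n*[n∸1]≤p[p+1] {p = p} n≤1+p = ≤-trans (*-mono-≤ n≤1+p (∸-monoˡ-≤ 1 n≤1+p)) (≤-reflexive (swap p))
  where
  swap : ∀ p → suc p * p ≡ p * (p + 1)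
  swap = solve-∀

p[p+1]+2[1+q]≤n*[n∸1]⇒2+p≤n : ∀ {n p q} → p * (p + 1) + 2 * suc q ≤ n * (n ∸ 1) → 2 + p ≤ n
p[p+1]+2[1+q]≤n*[n∸1]⇒2+p≤n {p = p} s≤n[n∸1] = ≮⇒≥ λ n<2+p →
  <⇒≱ (<-≤-trans (m<m+n (p * (p + 1)) z<s) s≤n[n∸1]) (n*[n∸1]≤p[p+1] (≤-pred n<2+p))

mSearch-least : ∀ {s K} f k → k ≤ K → K ≤ k + f → s ≤ K * (K ∸ 1) →
                (∀ {j} → j < K → j * (j ∸ 1) < s) → mSearch s f k ≡ K
mSearch-least {K = K} zero k k≤K K≤k+0 _ _ = ≤-antisym k≤K (subst (K ≤_) (+-identityʳ k) K≤k+0)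
mSearch-least {s} {K} (suc f) k k≤K K≤k+f s≤K[K∸1] least with s ≤? k * (k ∸ 1) | m≤n⇒m<n∨m≡n k≤K
... | yes s≤k[k∸1] | inj₁ k<K = contradiction s≤k[k∸1] (<⇒≱ (least k<K))
... | yes _        | inj₂ k≡K = k≡K
... | no  s≰k[k∸1] | inj₁ k<K =
  mSearch-least f (suc k) k<K (subst (K ≤_) (+-suc k f) K≤k+f) s≤K[K∸1] least
... | no  s≰k[k∸1] | inj₂ refl = contradiction s≤K[K∸1] s≰k[k∸1]

-- The fuel s + 2 of mOf is enough: minimality excludes K > s + 2, as s ≤ (s+2)(s+1).
mOf-least : ∀ {s K} → s ≤ K * (K ∸ 1) → (∀ {j} → j < K → j * (j ∸ 1) < s) → mOf s ≡ K
mOf-least {s} {K} s≤K[K∸1] least = mSearch-least (suc (suc s)) 0 z≤n K≤s+2 s≤K[K∸1] least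
  where
  K≤s+2 : K ≤ suc (suc s)
  K≤s+2 = ≮⇒≥ λ s+2<K → <⇒≱ (least s+2<K) (≤-trans (n≤1+n s) (m≤n*m (suc s) (suc (suc s))))

mOf-p[p+1]+2[1+q] : ∀ {p q} → q ≤ p → mOf (p * (p + 1) + 2 * suc q) ≡ 2 + p
mOf-p[p+1]+2[1+q] {p} {q} q≤p = mOf-least s≤ least
  where
  open ≤-Reasoning
  block-end : ∀ p → p * (p + 1) + 2 * suc p ≡ suc (suc p) * suc p
  block-end = solve-∀
  s≤ : p * (p + 1) + 2 * suc q ≤ suc (suc p) * suc p
  s≤ = begin
    p * (p + 1) + 2 * suc q  ≤⟨ +-monoʳ-≤ (p * (p + 1)) (*-monoʳ-≤ 2 (s≤s q≤p)) ⟩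
    p * (p + 1) + 2 * suc p  ≡⟨ block-end p ⟩
    suc (suc p) * suc p      ∎
  least : ∀ {j} → j < 2 + p → j * (j ∸ 1) < p * (p + 1) + 2 * suc q
  least j<2+p = ≤-<-trans (n*[n∸1]≤p[p+1] (≤-pred j<2+p)) (m<m+n (p * (p + 1)) z<s)

Tf-fuel : ∀ {f g n} s → n < f → n < g → Tf f n s ≡ Tf g n s
Tf-fuel zero (s≤s _) (s≤s _) = refl
Tf-fuel {n = zero} (suc s) (s≤s _) (s≤s _) = refl
Tf-fuel {n = suc n} (suc s) (s≤s n<f) (s≤s n<g) with mOf (suc s) <? suc n
... | yes m<n = cong (_++ replicate (suc n ∸ mOf (suc s)) 0)
                     (Tf-fuel (suc s) (<-≤-trans m<n n<f) (<-≤-trans m<n n<g))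
... | no  _   = cong (λ xs → n ∷ map suc xs) (Tf-fuel (suc s ∸ 2 * n) n<f n<g)

T-unpad : ∀ {s K n} → 0 < s → mOf s ≡ K → K < n → T n s ≡ T K s ++ replicate (n ∸ K) 0
T-unpad {suc s} {n = suc n} (s≤s z≤n) refl m<n with mOf (suc s) <? suc n
... | yes _   = cong (_++ replicate (suc n ∸ mOf (suc s)) 0) (Tf-fuel (suc s) m<n (n<1+n (mOf (suc s))))
... | no  m≮n = contradiction m<n m≮n

T-step : ∀ {s n} → 0 < s → suc n ≤ mOf s → T (suc n) s ≡ n ∷ map suc (T n (s ∸ 2 * n))
T-step {suc s} {n} (s≤s z≤n) n<m with mOf (suc s) <? suc n
... | yes m<n = contradiction n<m (<⇒≱ m<n)
... | no  _   = refl

profile : ℕ → ℕ → ℕ → List ℕ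
profile p q k = replicate q (suc p) ++ replicate (suc p ∸ q) p ++ q ∷ replicate k 0

closedForm : ℕ → ℕ → ℕ → List ℕ
closedForm n p q =
  take n (replicate q (p + 1) ++ replicate (p + 1 ∸ q) p ++ q ∷ replicate (n ∸ (p + 2)) 0)

replicate-++-∷ : ∀ {A : Set} n (x : A) ys → replicate n x ++ x ∷ ys ≡ replicate (suc n) x ++ ys
replicate-++-∷ zero    x ys = refl
replicate-++-∷ (suc n) x ys = cong (x ∷_) (replicate-++-∷ n x ys)

take-replicate-++ : ∀ {A : Set} n (x : A) ys → take n (replicate n x ++ ys) ≡ replicate n x
take-replicate-++ zero    x ys = refl
take-replicate-++ (suc n) x ys = cong (x ∷_) (take-replicate-++ n x ys)

length-profile : ∀ {p q} k → q ≤ suc p → length (profile p q k) ≡ 2 + p + k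
length-profile {p} {q} k q≤1+p = begin
  length (profile p q k)            ≡⟨ length-++ (replicate q (suc p)) ⟩
  length (replicate q (suc p)) + length (replicate (suc p ∸ q) p ++ q ∷ replicate k 0)
    ≡⟨ cong₂ _+_ (length-replicate q) (length-++ (replicate (suc p ∸ q) p)) ⟩
  q + (length (replicate (suc p ∸ q) p) + suc (length (replicate k 0)))
    ≡⟨ cong (λ l → q + l) (cong₂ (λ a b → a + suc b) (length-replicate (suc p ∸ q)) (length-replicate k)) ⟩
  q + (suc p ∸ q + suc k)           ≡⟨ sym (+-assoc q (suc p ∸ q) (suc k)) ⟩
  q + (suc p ∸ q) + suc k           ≡⟨ cong (_+ suc k) (m+[n∸m]≡n q≤1+p) ⟩
  suc p + suc k                     ≡⟨ +-suc (suc p) k ⟩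
  2 + p + k                         ∎
  where open ≡-Reasoning

profile-++-zeros : ∀ p q k → profile p q 0 ++ replicate k 0 ≡ profile p q k
profile-++-zeros p q k = begin
  (replicate q (suc p) ++ replicate (suc p ∸ q) p ++ q ∷ []) ++ replicate k 0
    ≡⟨ ++-assoc (replicate q (suc p)) _ (replicate k 0) ⟩
  replicate q (suc p) ++ (replicate (suc p ∸ q) p ++ q ∷ []) ++ replicate k 0
    ≡⟨ cong (replicate q (suc p) ++_) (++-assoc (replicate (suc p ∸ q) p) (q ∷ []) (replicate k 0)) ⟩
  profile p q k ∎
  where open ≡-Reasoning

profile-carry : ∀ p k → profile p (suc p) k ≡ replicate (2 + p) (suc p) ++ replicate k 0
profile-carry p k = begin
  replicate (suc p) (suc p) ++ replicate (p ∸ p) p ++ suc p ∷ replicate k 0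
    ≡⟨ cong (λ j → replicate (suc p) (suc p) ++ replicate j p ++ suc p ∷ replicate k 0) (n∸n≡0 p) ⟩
  replicate (suc p) (suc p) ++ suc p ∷ replicate k 0
    ≡⟨ replicate-++-∷ (suc p) (suc p) (replicate k 0) ⟩
  replicate (2 + p) (suc p) ++ replicate k 0 ∎
  where open ≡-Reasoning

∷-map-suc-profile : ∀ p q → 2 + p ∷ map suc (profile p q 0) ≡ profile (suc p) (suc q) 0
∷-map-suc-profile p q = cong (2 + p ∷_) (begin
  map suc (replicate q (suc p) ++ replicate (suc p ∸ q) p ++ q ∷ [])
    ≡⟨ map-++ suc (replicate q (suc p)) _ ⟩
  map suc (replicate q (suc p)) ++ map suc (replicate (suc p ∸ q) p ++ q ∷ [])
    ≡⟨ cong₂ _++_ (map-replicate suc q (suc p)) (map-++ suc (replicate (suc p ∸ q) p) (q ∷ [])) ⟩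
  replicate q (2 + p) ++ map suc (replicate (suc p ∸ q) p) ++ suc q ∷ []
    ≡⟨ cong (λ xs → replicate q (2 + p) ++ xs ++ suc q ∷ []) (map-replicate suc (suc p ∸ q) p) ⟩
  replicate q (2 + p) ++ replicate (suc p ∸ q) (suc p) ++ suc q ∷ [] ∎)
  where open ≡-Reasoning

closedForm≡take-profile : ∀ n p q → closedForm n p q ≡ take n (profile p q (n ∸ (2 + p)))
closedForm≡take-profile n p q =
  cong₂ (λ a b → take n (replicate q a ++ replicate (a ∸ q) p ++ q ∷ replicate (n ∸ b) 0))
        (+-comm p 1) (+-comm p 2)

closedForm-profile : ∀ {p q} k → q ≤ suc p → closedForm (2 + p + k) p q ≡ profile p q k
closedForm-profile {p} {q} k q≤1+p = begin
  closedForm (2 + p + k) p q                   ≡⟨ closedForm≡take-profile (2 + p + k) p q ⟩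
  take (2 + p + k) (profile p q (2 + p + k ∸ (2 + p)))
    ≡⟨ cong (λ j → take (2 + p + k) (profile p q j)) (m+n∸m≡n (2 + p) k) ⟩
  take (2 + p + k) (profile p q k)             ≡⟨ take-all (2 + p + k) _ (≤-reflexive (length-profile k q≤1+p)) ⟩
  profile p q k                                ∎
  where open ≡-Reasoning

closedForm-carry : ∀ p k → closedForm (2 + p + k) (suc p) 0 ≡ profile p (suc p) k
closedForm-carry p zero = begin
  closedForm (2 + p + 0) (suc p) 0
    ≡⟨ closedForm≡take-profile (2 + p + 0) (suc p) 0 ⟩
  take (2 + p + 0) (replicate (2 + p) (suc p) ++ zeros)
    ≡⟨ cong (λ n → take n (replicate (2 + p) (suc p) ++ zeros)) (+-identityʳ (2 + p)) ⟩
  take (2 + p) (replicate (2 + p) (suc p) ++ zeros)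
    ≡⟨ take-replicate-++ (2 + p) (suc p) zeros ⟩
  replicate (2 + p) (suc p)
    ≡⟨ ++-identityʳ (replicate (2 + p) (suc p)) ⟨
  replicate (2 + p) (suc p) ++ []
    ≡⟨ profile-carry p 0 ⟨
  profile p (suc p) 0 ∎
  where
  open ≡-Reasoning
  zeros = 0 ∷ replicate (2 + p + 0 ∸ (3 + p)) 0
closedForm-carry p (suc k) = begin
  closedForm (2 + p + suc k) (suc p) 0  ≡⟨ cong (λ n → closedForm n (suc p) 0) (+-suc (2 + p) k) ⟩
  closedForm (3 + p + k) (suc p) 0      ≡⟨ closedForm-profile k z≤n ⟩
  profile (suc p) 0 k                   ≡⟨ sym (profile-carry p (suc k)) ⟩
  profile p (suc p) (suc k)             ∎
  where open ≡-Reasoning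

p[p+1]+2[1+q]>0 : ∀ p q → 0 < p * (p + 1) + 2 * suc q
p[p+1]+2[1+q]>0 p q = <-≤-trans z<s (m≤n+m (2 * suc q) (p * (p + 1)))

p[p+1]+2q-carry : ∀ p → suc p * (suc p + 1) + 2 * 0 ≡ p * (p + 1) + 2 * suc p
p[p+1]+2q-carry = solve-∀

T-at-2+p : ∀ p q → q ≤ suc p → T (2 + p) (p * (p + 1) + 2 * q) ≡ profile p q 0
T-at-2+p zero    zero          _ = refl
T-at-2+p zero    (suc zero)    _ = refl
T-at-2+p zero    (suc (suc q)) (s≤s ())
-- s = (p+1)(p+2) ends the block of p, so m(s) = p + 2 and T(p+3, s) is a padding.
T-at-2+p (suc p) zero          _ = begin
  T (3 + p) (suc p * (suc p + 1) + 2 * 0)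
    ≡⟨ cong (T (3 + p)) (p[p+1]+2q-carry p) ⟩
  T (3 + p) s
    ≡⟨ T-unpad (p[p+1]+2[1+q]>0 p p) (mOf-p[p+1]+2[1+q] ≤-refl) (n<1+n (2 + p)) ⟩
  T (2 + p) s ++ replicate (1 + p ∸ p) 0
    ≡⟨ cong₂ _++_ (T-at-2+p p (suc p) ≤-refl) (cong (λ j → replicate j 0) (m+n∸n≡m 1 p)) ⟩
  profile p (suc p) 0 ++ replicate 1 0 ≡⟨ profile-++-zeros p (suc p) 1 ⟩
  profile p (suc p) 1                  ≡⟨ profile-carry p 1 ⟩
  profile (suc p) 0 0                  ∎
  where
  open ≡-Reasoning
  s = p * (p + 1) + 2 * suc p
T-at-2+p (suc p) (suc q) (s≤s q≤1+p) = begin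
  T (3 + p) s
    ≡⟨ T-step (p[p+1]+2[1+q]>0 (suc p) q) (≤-reflexive (sym (mOf-p[p+1]+2[1+q] q≤1+p))) ⟩
  2 + p ∷ map suc (T (2 + p) (s ∸ 2 * (2 + p)))
    ≡⟨ cong (λ s′ → 2 + p ∷ map suc (T (2 + p) s′)) s∸2[2+p]≡ ⟩
  2 + p ∷ map suc (T (2 + p) (p * (p + 1) + 2 * q))
    ≡⟨ cong (λ xs → 2 + p ∷ map suc xs) (T-at-2+p p q q≤1+p) ⟩
  2 + p ∷ map suc (profile p q 0)
    ≡⟨ ∷-map-suc-profile p q ⟩
  profile (suc p) (suc q) 0 ∎
  where
  open ≡-Reasoning
  s = suc p * (suc p + 1) + 2 * suc q
  step : ∀ p q → suc p * (suc p + 1) + 2 * suc q ≡ p * (p + 1) + 2 * q + 2 * (2 + p)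
  step = solve-∀
  s∸2[2+p]≡ : s ∸ 2 * (2 + p) ≡ p * (p + 1) + 2 * q
  s∸2[2+p]≡ =
    trans (cong (_∸ 2 * (2 + p)) (step p q)) (m+n∸n≡m (p * (p + 1) + 2 * q) (2 * (2 + p)))

T-at-2+p+k : ∀ {p q} k → q ≤ p → T (2 + p + k) (p * (p + 1) + 2 * suc q) ≡ profile p (suc q) k
T-at-2+p+k {p} {q} zero q≤p =
  trans (cong (λ n → T n s) (+-identityʳ (2 + p))) (T-at-2+p p (suc q) (s≤s q≤p))
  where s = p * (p + 1) + 2 * suc q
T-at-2+p+k {p} {q} (suc k) q≤p = begin
  T (2 + p + suc k) s
    ≡⟨ T-unpad (p[p+1]+2[1+q]>0 p q) (mOf-p[p+1]+2[1+q] q≤p) (m<m+n (2 + p) z<s) ⟩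
  T (2 + p) s ++ replicate (2 + p + suc k ∸ (2 + p)) 0
    ≡⟨ cong₂ _++_ (T-at-2+p p (suc q) (s≤s q≤p)) (cong (λ j → replicate j 0) (m+n∸m≡n (2 + p) (suc k))) ⟩
  profile p (suc q) 0 ++ replicate (suc k) 0
    ≡⟨ profile-++-zeros p (suc q) (suc k) ⟩
  profile p (suc q) (suc k) ∎
  where
  open ≡-Reasoning
  s = p * (p + 1) + 2 * suc q

T-closedForm : ∀ n p q → q ≤ p → p * (p + 1) + 2 * q ≤ n * (n ∸ 1) →
               T n (p * (p + 1) + 2 * q) ≡ closedForm n p q
T-closedForm zero          zero    zero    _ _ = refl
T-closedForm (suc zero)    zero    zero    _ _ = refl
T-closedForm (suc (suc k)) zero    zero    _ _ = sym (closedForm-profile k z≤n)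
T-closedForm n             p       (suc q) q<p s≤n[n∸1]
  with m≤n⇒∃[o]m+o≡n (p[p+1]+2[1+q]≤n*[n∸1]⇒2+p≤n {n} {p} s≤n[n∸1])
... | k , refl = trans (T-at-2+p+k k (<⇒≤ q<p)) (sym (closedForm-profile k (≤-trans q<p (n≤1+n p))))
T-closedForm n             (suc p) zero    _   s≤n[n∸1]
  with m≤n⇒∃[o]m+o≡n
         (p[p+1]+2[1+q]≤n*[n∸1]⇒2+p≤n {n} {p} (subst (_≤ n * (n ∸ 1)) (p[p+1]+2q-carry p) s≤n[n∸1]))
... | k , refl = begin
  T (2 + p + k) (suc p * (suc p + 1) + 2 * 0)  ≡⟨ cong (T (2 + p + k)) (p[p+1]+2q-carry p) ⟩
  T (2 + p + k) (p * (p + 1) + 2 * suc p)      ≡⟨ T-at-2+p+k k ≤-refl ⟩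
  profile p (suc p) k                          ≡⟨ closedForm-carry p k ⟨
  closedForm (2 + p + k) (suc p) 0             ∎
  where open ≡-Reasoning

theorem4 : (n s : ℕ) → n ≥ 1 → 2 ∣ s → s ≤ n * (n ∸ 1) →
    T n s ≡ take n (replicate (qOf s) (pOf s + 1) ++ replicate (pOf s + 1 ∸ qOf s) (pOf s) ++ qOf s ∷ replicate (n ∸ (pOf s + 2)) 0)
theorem4 n s _ (divides k s≡k*2) s≤n[n∸1] with even≡p[p+1]+2q k
... | p , q , q≤p , k*2≡ = begin
  T n s                         ≡⟨ cong (T n) s≡ ⟩
  T n (p * (p + 1) + 2 * q)     ≡⟨ T-closedForm n p q q≤p (subst (_≤ n * (n ∸ 1)) s≡ s≤n[n∸1]) ⟩
  closedForm n p q              ≡⟨ cong₂ (closedForm n) pOf≡p qOf≡q ⟨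
  closedForm n (pOf s) (qOf s)  ∎
  where
  open ≡-Reasoning
  s≡ : s ≡ p * (p + 1) + 2 * q
  s≡ = trans s≡k*2 k*2≡
  pOf≡p : pOf s ≡ p
  pOf≡p = trans (cong pOf s≡) (pOf-p[p+1]+2q q≤p)
  qOf≡q : qOf s ≡ q
  qOf≡q = trans (cong qOf s≡) (qOf-p[p+1]+2q q≤p)
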